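{- Let $n\ge 2$, let $P_n$ be the path graph with vertex set $\{1,\dots,n\}$ and edges $\{i,i+1\}$ for $1\le i<n$, and let $f$ be the configuration on $P_n$ with $f(1)=n$, $f(n)=1$ and $f(i)=i$ for $1<i<n$. Then $\mathsf{rt}(P_n,f)=n-1$ if $n$ is even, and $\mathsf{rt}(P_n,f)=n$ if $n$ is odd.
   Context: A configuration on a graph $G=(V,E)$ is a bijection $f:V\to V$. A parallel swap is a matching $S\subseteq E$; $fS(u)=f(v)$ if $\{u,v\}\in S$ and $fS(u)=f(u)$ if $u$ is covered by no edge of $S$; sequences are applied left to right. $\mathsf{rt}(G,f)$ is the minimum $m$ such that there are parallel swaps $S_1,\dots,S_m$ with $f\langle S_1,\dots,S_m\rangle$ equal to the identity map. -}

module Defs where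

open import Data.Nat using (ℕ; zero; suc; _<_; _≡ᵇ_)
open import Data.Fin using (Fin; toℕ; opposite)
open import Data.Bool using (Bool; true; false; _∨_; if_then_else_)
open import Data.Vec using (Vec; []; _∷_)
open import Data.Product using (Σ; _×_; _,_)
open import Relation.Binary.PropositionalEquality using (_≡_)
open import Relation.Nullary using (¬_)

record Graph (n : ℕ) : Set where
  field
    adj : Fin n → Fin n → Bool

open Graph public

-- The path graph P_n on vertices {0,…,n-1} (paper's {1,…,n} shifted by one):
-- edges {i, i+1}.
Path : (n : ℕ) → Graph n
Path n = record { adj = λ i j → (toℕ j ≡ᵇ suc (toℕ i)) ∨ (toℕ i ≡ᵇ suc (toℕ j)) }

-- A configuration: a map V → V (the configurations considered are bijections).
Config : ℕ → Set
Config n = Fin n → Fin n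

-- A parallel swap: a set S of edges of G (symmetric Boolean relation contained in
-- the adjacency) which is a matching (every vertex lies on at most one edge of S).
record Swap {n : ℕ} (G : Graph n) : Set where
  field
    sel      : Fin n → Fin n → Bool
    sym      : ∀ u v → sel u v ≡ true → sel v u ≡ true
    sub      : ∀ u v → sel u v ≡ true → adj G u v ≡ true
    matching : ∀ u v w → sel u v ≡ true → sel u w ≡ true → v ≡ w

open Swap public

Step : {n : ℕ} {G : Graph n} → Config n → Swap G → Config n → Set
Step {n} f S g =
  ∀ u → ((∀ v → sel S u v ≡ true → g u ≡ f v)
        × ((∀ v → sel S u v ≡ false) → g u ≡ f u))

data Applies {n : ℕ} {G : Graph n} : {k : ℕ} → Config n → Vec (Swap G) k → Config n → Set where
  done : ∀ {f h} → (∀ u → f u ≡ h u) → Applies f [] h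
  step : ∀ {k f g h S} {Ss : Vec (Swap G) k} →
         Step f S g → Applies g Ss h → Applies f (S ∷ Ss) h

SortableIn : {n : ℕ} → Graph n → Config n → ℕ → Set
SortableIn {n} G f k = Σ (Vec (Swap G) k) λ Ss → Applies f Ss (λ u → u)

RtIs : {n : ℕ} → Graph n → Config n → ℕ → Set
RtIs G f m = SortableIn G f m × (∀ k → k < m → ¬ SortableIn G f k)

swapEnds : (n : ℕ) → Config n
swapEnds n i =
  if (toℕ i ≡ᵇ 0) ∨ (suc (toℕ i) ≡ᵇ n) then opposite i else i

-- Upper bound: exchanging the vertices a and b is the conjugate of exchanging
-- a+1 and b-1 by the parallel swap of the edges {a,a+1} and {b-1,b}, so an
-- exchange at distance d+2 costs two rounds more than one at distance d, while
-- distances 1 and 2 cost 1 and 3 rounds.  This gives n-1 rounds for n even and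
-- n rounds for n odd.
-- Lower bound: a token moves by at most one vertex per round, so the tokens on
-- the two end vertices need n-1 rounds.  With exactly n-1 rounds both must
-- move towards each other in every round, and for odd n they would reach the
-- middle vertex at the same time.
module Submission where

open import Defs
open import Data.Nat
  using (ℕ; zero; suc; _+_; _*_; _/_; _≤_; _<_; _∸_; _%_; _≡ᵇ_; ∣_-_∣; z≤n; s≤s; s≤s⁻¹)
open import Data.Nat.Properties
open import Data.Nat.DivMod using (m≡m%n+[m/n]*n)
open import Data.Fin using (Fin; toℕ; fromℕ; fromℕ<; opposite) renaming (zero to fzero; suc to fsuc)
open import Data.Fin.Properties using (toℕ-injective; toℕ-fromℕ; toℕ-fromℕ<; toℕ<n; opposite-prop; any?)
  renaming (_≟_ to _≟ᶠ_)
open import Data.Bool using (Bool; true; false; _∧_; if_then_else_)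
open import Data.Bool.Properties using (∨-comm; ¬-not; T-≡; T-∨) renaming (_≟_ to _≟ᵇ_)
open import Data.Vec using (Vec; []; _∷_; _∷ʳ_; map)
open import Data.Sum using (_⊎_; inj₁; inj₂)
import Data.Sum as Sum
open import Data.Product using (_×_; _,_; proj₁; proj₂; ∃-syntax)
open import Function using (_∘_; _⇔_; mk⇔; Equivalence)
open import Relation.Nullary using (¬_; yes; no; does; contradiction)
open import Relation.Nullary.Decidable using (dec-true; dec-false)
open import Relation.Binary.Definitions using (DecidableEquality)
open import Relation.Binary.PropositionalEquality
  using (_≡_; _≢_; refl; trans; cong; cong₂; subst; module ≡-Reasoning)
import Relation.Binary.PropositionalEquality as ≡

module Transposition {ℓ} {A : Set ℓ} (_≟_ : DecidableEquality A) where

  transpose : A → A → A → A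
  transpose x y z with z ≟ x
  ... | yes _ = y
  ... | no _ with z ≟ y
  ...   | yes _ = x
  ...   | no _ = z

  transpose-matchˡ : ∀ x y → transpose x y x ≡ y
  transpose-matchˡ x y with x ≟ x
  ... | yes _ = refl
  ... | no x≢x = contradiction refl x≢x

  transpose-matchʳ : ∀ x y → transpose x y y ≡ x
  transpose-matchʳ x y with y ≟ x
  ... | yes y≡x = y≡x
  ... | no _ with y ≟ y
  ...   | yes _ = refl
  ...   | no y≢y = contradiction refl y≢y

  transpose-fix : ∀ {x y z} → z ≢ x → z ≢ y → transpose x y z ≡ z
  transpose-fix {x} {y} {z} z≢x z≢y with z ≟ x
  ... | yes z≡x = contradiction z≡x z≢x
  ... | no _ with z ≟ y
  ...   | yes z≡y = contradiction z≡y z≢y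
  ...   | no _ = refl

  transpose-preserves : ∀ {p} (P : A → Set p) {x y z} → P x → P y → P z → P (transpose x y z)
  transpose-preserves P {x} {y} {z} px py pz with z ≟ x
  ... | yes _ = py
  ... | no _ with z ≟ y
  ...   | yes _ = px
  ...   | no _ = pz

  transpose-related : ∀ {r} (R : A → A → Set r) {x y} → R x y → R y x → (∀ z → R z z) →
                      ∀ z → R z (transpose x y z)
  transpose-related R {x} {y} rxy ryx rzz z with z ≟ x
  ... | yes refl = rxy
  ... | no _ with z ≟ y
  ...   | yes refl = ryx
  ...   | no _ = rzz z

  transpose-involutive : ∀ x y z → transpose x y (transpose x y z) ≡ z
  transpose-involutive x y z with z ≟ x
  ... | yes refl = transpose-matchʳ z y
  ... | no z≢x with z ≟ y
  ...   | yes refl = transpose-matchˡ x z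
  ...   | no z≢y = transpose-fix z≢x z≢y

  transpose-conjugate : ∀ {σ : A → A} → (∀ z → σ (σ z) ≡ z) →
                        ∀ x y z → σ (transpose x y (σ z)) ≡ transpose (σ x) (σ y) z
  transpose-conjugate {σ} σ-involutive x y z with z ≟ σ x
  ... | yes refl = cong σ (trans (cong (transpose x y) (σ-involutive x)) (transpose-matchˡ x y))
  ... | no z≢σx with z ≟ σ y
  ...   | yes refl = cong σ (trans (cong (transpose x y) (σ-involutive y)) (transpose-matchʳ x y))
  ...   | no z≢σy = trans (cong σ (transpose-fix (unmoved z≢σx) (unmoved z≢σy))) (σ-involutive z)
    where
    unmoved : ∀ {w} → z ≢ σ w → σ z ≢ w
    unmoved z≢σw σz≡w = z≢σw (trans (≡.sym (σ-involutive z)) (cong σ σz≡w))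

  transpose-comm : ∀ {w x y z} → y ≢ w → y ≢ x → z ≢ w → z ≢ x →
                   ∀ v → transpose w x (transpose y z v) ≡ transpose y z (transpose w x v)
  transpose-comm {w} {x} {y} {z} y≢w y≢x z≢w z≢x v = begin
    τ (transpose y z v)                ≡⟨ cong (τ ∘ transpose y z) (≡.sym (transpose-involutive w x v)) ⟩
    τ (transpose y z (τ (τ v)))        ≡⟨ transpose-conjugate (transpose-involutive w x) y z (τ v) ⟩
    transpose (τ y) (τ z) (τ v)        ≡⟨ cong₂ (λ y′ z′ → transpose y′ z′ (τ v))
                                                (transpose-fix y≢w y≢x) (transpose-fix z≢w z≢x) ⟩
    transpose y z (τ v)                ∎
    where
    open ≡-Reasoning
    τ : A → A
    τ = transpose w x

open Transposition _≟_

Adjacent : ℕ → ℕ → Set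
Adjacent x y = y ≡ suc x ⊎ x ≡ suc y

Near : ℕ → ℕ → Set
Near x y = x ≡ y ⊎ Adjacent x y

Path-adj⇔Adjacent : ∀ {n} (u v : Fin n) → adj (Path n) u v ≡ true ⇔ Adjacent (toℕ u) (toℕ v)
Path-adj⇔Adjacent u v = mk⇔
  (Sum.map (≡ᵇ⇒≡ _ _) (≡ᵇ⇒≡ _ _) ∘ Equivalence.to T-∨ ∘ Equivalence.from T-≡)
  (Equivalence.to T-≡ ∘ Equivalence.from T-∨ ∘ Sum.map (≡⇒≡ᵇ _ _) (≡⇒≡ᵇ _ _))

Path-adj-comm : ∀ {n} (u v : Fin n) → adj (Path n) u v ≡ adj (Path n) v u
Path-adj-comm u v = ∨-comm (toℕ v ≡ᵇ suc (toℕ u)) (toℕ u ≡ᵇ suc (toℕ v))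

∣n-1+n∣≡1 : ∀ n → ∣ n - suc n ∣ ≡ 1
∣n-1+n∣≡1 zero = refl
∣n-1+n∣≡1 (suc n) = ∣n-1+n∣≡1 n

Near⇒∣-∣≤1 : ∀ {x y} → Near x y → ∣ x - y ∣ ≤ 1
Near⇒∣-∣≤1 {x} (inj₁ refl) = subst (_≤ 1) (≡.sym (∣n-n∣≡0 x)) z≤n
Near⇒∣-∣≤1 {x} (inj₂ (inj₁ refl)) = ≤-reflexive (∣n-1+n∣≡1 x)
Near⇒∣-∣≤1 {y = y} (inj₂ (inj₂ refl)) = ≤-reflexive (trans (∣-∣-comm (suc y) y) (∣n-1+n∣≡1 y))

Near-< : ∀ {x y} → Near x y → x < y → y ≡ suc x
Near-< (inj₁ refl) x<x = contradiction x<x (<-irrefl refl)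
Near-< (inj₂ (inj₁ y≡1+x)) _ = y≡1+x
Near-< {y = y} (inj₂ (inj₂ refl)) 1+y<y = contradiction 1+y<y (<-asym (n<1+n y))

Near-> : ∀ {x y} → Near x y → y < x → suc y ≡ x
Near-> (inj₁ refl) x<x = contradiction x<x (<-irrefl refl)
Near-> {x} (inj₂ (inj₁ refl)) 1+x<x = contradiction 1+x<x (<-asym (n<1+n x))
Near-> (inj₂ (inj₂ x≡1+y)) _ = ≡.sym x≡1+y

toℕ-swapEnds : ∀ {m} (u : Fin (suc m)) → toℕ (swapEnds (suc m) u) ≡ transpose 0 m (toℕ u)
toℕ-swapEnds {m} fzero = trans (toℕ-fromℕ m) (≡.sym (transpose-matchˡ 0 m))
toℕ-swapEnds {suc m} (fsuc v) with toℕ v ≟ m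
... | yes v≡m = begin
  toℕ (swapEnds (suc (suc m)) (fsuc v)) ≡⟨ cong (λ c → toℕ (if c then opposite (fsuc v) else fsuc v))
                                                  (dec-true (toℕ v ≟ m) v≡m) ⟩
  toℕ (opposite (fsuc v))               ≡⟨ opposite-prop (fsuc v) ⟩
  m ∸ toℕ v                             ≡⟨ cong (m ∸_) v≡m ⟩
  m ∸ m                                 ≡⟨ n∸n≡0 m ⟩
  0                                     ≡⟨ ≡.sym (transpose-matchʳ 0 (suc m)) ⟩
  transpose 0 (suc m) (suc m)           ≡⟨ cong (transpose 0 (suc m) ∘ suc) (≡.sym v≡m) ⟩
  transpose 0 (suc m) (suc (toℕ v))     ∎
  where open ≡-Reasoning
... | no v≢m = begin
  toℕ (swapEnds (suc (suc m)) (fsuc v)) ≡⟨ cong (λ c → toℕ (if c then opposite (fsuc v) else fsuc v))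
                                                  (dec-false (toℕ v ≟ m) v≢m) ⟩
  suc (toℕ v)                           ≡⟨ ≡.sym (transpose-fix 1+n≢0 (v≢m ∘ suc-injective)) ⟩
  transpose 0 (suc m) (suc (toℕ v))     ∎
  where open ≡-Reasoning

-- In a configuration f, vertex u carries the token f u.

step-carries : ∀ {n} {f g : Config n} {S : Swap (Path n)} → Step f S g →
               ∀ {u x} → f u ≡ x → ∃[ u′ ] g u′ ≡ x × Near (toℕ u) (toℕ u′)
step-carries {S = S} st {u} fu≡x with any? (λ v → sel S u v ≟ᵇ true)
... | yes (v , uv) = v , trans (proj₁ (st v) u (sym S u v uv)) fu≡x
                       , inj₂ (Equivalence.to (Path-adj⇔Adjacent u v) (sub S u v uv))
... | no uncovered = u , trans (proj₂ (st u) (λ v → ¬-not (λ uv → uncovered (v , uv)))) fu≡x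
                       , inj₁ refl

displacement : ∀ {n k} {f : Config n} {Ss : Vec (Swap (Path n)) k} → Applies f Ss (λ u → u) →
               ∀ {u x} → f u ≡ x → ∣ toℕ u - toℕ x ∣ ≤ k
displacement (done sorted) {u} refl =
  ≤-reflexive (trans (cong (λ v → ∣ toℕ u - toℕ v ∣) (sorted u)) (∣n-n∣≡0 (toℕ u)))
displacement {f = f} (step {g = g} {S = S} st rest) {u} {x} fu≡x
  with step-carries {f = f} {g = g} {S = S} st fu≡x
... | u′ , gu′≡x , near =
  ≤-trans (∣-∣-triangle (toℕ u) (toℕ u′) (toℕ x))
          (+-mono-≤ (Near⇒∣-∣≤1 near) (displacement rest gu′≡x))

rush-forward : ∀ {n k} {f g : Config n} {S : Swap (Path n)} {Ss : Vec (Swap (Path n)) k} →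
               Step f S g → Applies g Ss (λ u → u) →
               ∀ {p a} → f p ≡ a → toℕ a ≡ toℕ p + suc k →
               ∃[ p′ ] g p′ ≡ a × toℕ p′ ≡ suc (toℕ p)
rush-forward {k = k} {f = f} {g = g} {S = S} st rest {p} {a} fp≡a a≡p+1+k
  with step-carries {f = f} {g = g} {S = S} st fp≡a
... | p′ , gp′≡a , near = p′ , gp′≡a , Near-< near (+-cancelʳ-≤ k (suc (toℕ p)) (toℕ p′) (begin
  suc (toℕ p) + k                 ≡⟨ ≡.sym (+-suc (toℕ p) k) ⟩
  toℕ p + suc k                   ≡⟨ ≡.sym a≡p+1+k ⟩
  toℕ a                           ≤⟨ m≤n+∣n-m∣ (toℕ a) (toℕ p′) ⟩
  toℕ p′ + ∣ toℕ p′ - toℕ a ∣     ≤⟨ +-monoʳ-≤ (toℕ p′) (displacement rest gp′≡a) ⟩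
  toℕ p′ + k                      ∎))
  where open ≤-Reasoning

rush-backward : ∀ {n k} {f g : Config n} {S : Swap (Path n)} {Ss : Vec (Swap (Path n)) k} →
                Step f S g → Applies g Ss (λ u → u) →
                ∀ {q b} → f q ≡ b → toℕ q ≡ toℕ b + suc k →
                ∃[ q′ ] g q′ ≡ b × suc (toℕ q′) ≡ toℕ q
rush-backward {k = k} {f = f} {g = g} {S = S} st rest {q} {b} fq≡b q≡b+1+k
  with step-carries {f = f} {g = g} {S = S} st fq≡b
... | q′ , gq′≡b , near = q′ , gq′≡b , Near-> near (begin-strict
  toℕ q′                          ≤⟨ m≤n+∣m-n∣ (toℕ q′) (toℕ b) ⟩
  toℕ b + ∣ toℕ q′ - toℕ b ∣      ≤⟨ +-monoʳ-≤ (toℕ b) (displacement rest gq′≡b) ⟩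
  toℕ b + k                       <⟨ +-monoʳ-< (toℕ b) (n<1+n k) ⟩
  toℕ b + suc k                   ≡⟨ ≡.sym q≡b+1+k ⟩
  toℕ q                           ∎)
  where open ≤-Reasoning

-- Tokens a and b whose distance to their targets equals the number k of
-- remaining rounds must approach each other in every round; starting 2j ≤ 2k
-- apart, they meet after j rounds.
collide : ∀ j {n k} {f : Config n} {Ss : Vec (Swap (Path n)) k} → Applies f Ss (λ u → u) →
          ∀ {p q a b} → f p ≡ a → f q ≡ b → toℕ a ≡ toℕ p + k → toℕ q ≡ toℕ b + k →
          toℕ q ≡ j + (j + toℕ p) → j ≤ k → a ≡ b
collide zero {f = f} _ fp≡a fq≡b _ _ q≡p _ =
  trans (≡.sym fp≡a) (trans (cong f (toℕ-injective (≡.sym q≡p))) fq≡b)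
collide (suc j) {k = suc k} {f = f} (step {g = g} {S = S} st rest) {p} {q} {a} {b}
  fp≡a fq≡b a≡p+k q≡b+k q≡2j+p (s≤s j≤k)
  with rush-forward {f = f} {g = g} {S = S} st rest fp≡a a≡p+k
     | rush-backward {f = f} {g = g} {S = S} st rest fq≡b q≡b+k
... | p′ , gp′≡a , p′≡1+p | q′ , gq′≡b , 1+q′≡q =
  collide j rest gp′≡a gq′≡b a≡p′+k q′≡b+k q′≡2j+p′ j≤k
  where
  open ≡-Reasoning
  a≡p′+k : toℕ a ≡ toℕ p′ + k
  a≡p′+k = begin
    toℕ a           ≡⟨ a≡p+k ⟩
    toℕ p + suc k   ≡⟨ +-suc (toℕ p) k ⟩
    suc (toℕ p) + k ≡⟨ cong (_+ k) (≡.sym p′≡1+p) ⟩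
    toℕ p′ + k      ∎
  q′≡b+k : toℕ q′ ≡ toℕ b + k
  q′≡b+k = suc-injective (trans 1+q′≡q (trans q≡b+k (+-suc (toℕ b) k)))
  q′≡2j+p′ : toℕ q′ ≡ j + (j + toℕ p′)
  q′≡2j+p′ = suc-injective (begin
    suc (toℕ q′)                ≡⟨ 1+q′≡q ⟩
    toℕ q                       ≡⟨ q≡2j+p ⟩
    suc (j + suc (j + toℕ p))   ≡⟨ cong (λ r → suc (j + r)) (≡.sym (+-suc j (toℕ p))) ⟩
    suc (j + (j + suc (toℕ p))) ≡⟨ cong (λ r → suc (j + (j + r))) (≡.sym p′≡1+p) ⟩
    suc (j + (j + toℕ p′))      ∎)

-- A parallel swap of the path, presented as the involution of the vertex labels
-- that exchanges the two ends of every chosen edge.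
record PathMatching (n : ℕ) : Set where
  field
    σ          : ℕ → ℕ
    involutive : ∀ x → σ (σ x) ≡ x
    near       : ∀ x → Near x (σ x)
    bounded    : ∀ x → x < n → σ x < n

open PathMatching

module _ {n} (M : PathMatching n) where

  σᶠ : Fin n → Fin n
  σᶠ u = fromℕ< (bounded M (toℕ u) (toℕ<n u))

  toℕ-σᶠ : ∀ u → toℕ (σᶠ u) ≡ σ M (toℕ u)
  toℕ-σᶠ u = toℕ-fromℕ< _

  σᶠ-involutive : ∀ u → σᶠ (σᶠ u) ≡ u
  σᶠ-involutive u = toℕ-injective (begin
    toℕ (σᶠ (σᶠ u))     ≡⟨ toℕ-σᶠ (σᶠ u) ⟩
    σ M (toℕ (σᶠ u))    ≡⟨ cong (σ M) (toℕ-σᶠ u) ⟩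
    σ M (σ M (toℕ u))   ≡⟨ involutive M (toℕ u) ⟩
    toℕ u               ∎)
    where open ≡-Reasoning

  selected : Fin n → Fin n → Bool
  selected u v = does (σᶠ u ≟ᶠ v) ∧ adj (Path n) u v

  selected-intro : ∀ {u v} → σᶠ u ≡ v → adj (Path n) u v ≡ true → selected u v ≡ true
  selected-intro {u} {v} σu≡v uv = cong₂ _∧_ (dec-true (σᶠ u ≟ᶠ v) σu≡v) uv

  selected-elim : ∀ {u v} → selected u v ≡ true → σᶠ u ≡ v × adj (Path n) u v ≡ true
  selected-elim {u} {v} e with σᶠ u ≟ᶠ v
  ... | yes σu≡v = σu≡v , e
  ... | no _ = contradiction e λ ()

  toSwap : Swap (Path n)
  toSwap = record
    { sel      = selected
    ; sym      = λ u v e → let σu≡v , uv = selected-elim e in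
                   selected-intro (trans (cong σᶠ (≡.sym σu≡v)) (σᶠ-involutive u))
                                  (trans (Path-adj-comm v u) uv)
    ; sub      = λ u v e → proj₂ (selected-elim e)
    ; matching = λ u v w e e′ → trans (≡.sym (proj₁ (selected-elim e))) (proj₁ (selected-elim e′))
    }

  uncovered-fixed : ∀ {u} → (∀ v → selected u v ≡ false) → σᶠ u ≡ u
  uncovered-fixed {u} uncovered with near M (toℕ u)
  ... | inj₁ u≡σu = toℕ-injective (trans (toℕ-σᶠ u) (≡.sym u≡σu))
  ... | inj₂ u~σu = contradiction (trans (≡.sym (uncovered (σᶠ u))) (selected-intro refl u-adj-σu)) λ ()
    where
    u-adj-σu : adj (Path n) u (σᶠ u) ≡ true
    u-adj-σu = Equivalence.from (Path-adj⇔Adjacent u (σᶠ u))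
                                (subst (Adjacent (toℕ u)) (≡.sym (toℕ-σᶠ u)) u~σu)

  step-toSwap : ∀ f → Step f toSwap (f ∘ σᶠ)
  step-toSwap f u = (λ v e → cong f (proj₁ (selected-elim e))) , cong f ∘ uncovered-fixed

compose : ∀ {n k} → Vec (PathMatching n) k → ℕ → ℕ
compose [] x = x
compose (M ∷ Ms) x = σ M (compose Ms x)

compose-∷ʳ : ∀ {n k} (Ms : Vec (PathMatching n) k) M x → compose (Ms ∷ʳ M) x ≡ compose Ms (σ M x)
compose-∷ʳ [] M x = refl
compose-∷ʳ (M′ ∷ Ms) M x = cong (σ M′) (compose-∷ʳ Ms M x)

matchings-sort : ∀ {n k} (Ms : Vec (PathMatching n) k) (f : Config n) →
                 (∀ u v → toℕ v ≡ compose Ms (toℕ u) → f v ≡ u) →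
                 Applies f (map toSwap Ms) (λ u → u)
matchings-sort [] f sorted = done (λ u → sorted u u refl)
matchings-sort (M ∷ Ms) f sorted = step (step-toSwap M f) (matchings-sort Ms (f ∘ σᶠ M) sorted′)
  where
  sorted′ : ∀ u v → toℕ v ≡ compose Ms (toℕ u) → f (σᶠ M v) ≡ u
  sorted′ u v v≡ = sorted u (σᶠ M v) (trans (toℕ-σᶠ M v) (cong (σ M) v≡))

swapAt : ℕ → ℕ → ℕ
swapAt a = transpose a (suc a)

swapAt-near : ∀ a x → Near x (swapAt a x)
swapAt-near a = transpose-related Near (inj₂ (inj₁ refl)) (inj₂ (inj₂ refl)) (λ _ → inj₁ refl)

adjacentSwap : ∀ {n} a → suc a < n → PathMatching n
adjacentSwap {n} a 1+a<n = record
  { σ          = swapAt a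
  ; involutive = transpose-involutive a (suc a)
  ; near       = swapAt-near a
  ; bounded    = λ x x<n → transpose-preserves (_< n) (<-trans (n<1+n a) 1+a<n) 1+a<n x<n
  }

module TwoEdges {a b : ℕ} (1+a<b : suc a < b) where

  private
    a<b : a < b
    a<b = <-trans (n<1+n a) 1+a<b

    swapAt-a-fixes-b : swapAt a b ≡ b
    swapAt-a-fixes-b = transpose-fix (>⇒≢ a<b) (>⇒≢ 1+a<b)

    swapAt-a-fixes-1+b : swapAt a (suc b) ≡ suc b
    swapAt-a-fixes-1+b = transpose-fix (>⇒≢ (m<n⇒m<1+n a<b)) (>⇒≢ (s≤s a<b))

  swapBoth : ℕ → ℕ
  swapBoth x = swapAt a (swapAt b x)

  swapBoth-suc-a : swapBoth (suc a) ≡ a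
  swapBoth-suc-a = trans (cong (swapAt a) (transpose-fix (<⇒≢ 1+a<b) (<⇒≢ (s≤s a<b))))
                         (transpose-matchʳ a (suc a))

  swapBoth-b : swapBoth b ≡ suc b
  swapBoth-b = trans (cong (swapAt a) (transpose-matchˡ b (suc b))) swapAt-a-fixes-1+b

  swapBoth-involutive : ∀ x → swapBoth (swapBoth x) ≡ x
  swapBoth-involutive x = begin
    swapAt a (swapAt b (swapAt a (swapAt b x))) ≡⟨ cong (swapAt a) (commute (swapAt b x)) ⟩
    swapAt a (swapAt a (swapAt b (swapAt b x))) ≡⟨ transpose-involutive a (suc a) _ ⟩
    swapAt b (swapAt b x)                       ≡⟨ transpose-involutive b (suc b) x ⟩
    x                                           ∎
    where
    open ≡-Reasoning
    commute : ∀ y → swapAt b (swapAt a y) ≡ swapAt a (swapAt b y)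
    commute = transpose-comm (<⇒≢ a<b) (<⇒≢ (m<n⇒m<1+n a<b)) (<⇒≢ 1+a<b) (<⇒≢ (s≤s a<b))

  swapBoth-near : ∀ x → Near x (swapBoth x)
  swapBoth-near = transpose-related (λ x y → Near x (swapAt a y))
    (subst (Near b) (≡.sym swapAt-a-fixes-1+b) (inj₂ (inj₁ refl)))
    (subst (Near (suc b)) (≡.sym swapAt-a-fixes-b) (inj₂ (inj₂ refl)))
    (swapAt-near a)

  doubleSwap : ∀ {n} → suc b < n → PathMatching n
  doubleSwap {n} 1+b<n = record
    { σ          = swapBoth
    ; involutive = swapBoth-involutive
    ; near       = swapBoth-near
    ; bounded    = λ x x<n → bounded (adjacentSwap a 1+a<n) _ (bounded (adjacentSwap b 1+b<n) x x<n)
    }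
    where
    1+a<n : suc a < n
    1+a<n = <-trans 1+a<b (<-trans (n<1+n b) 1+b<n)

open TwoEdges

rounds : ℕ → ℕ
rounds zero = 1
rounds (suc zero) = 3
rounds (suc (suc e)) = suc (suc (rounds e))

1+a<2+e+a : ∀ e a → suc a < suc (suc e) + a
1+a<2+e+a e a = s≤s (s≤s (m≤n+m a e))

3+e+a<n⇒1+e+[1+a]<n : ∀ {n} e a → suc (suc (suc e)) + a < n → suc e + suc a < n
3+e+a<n⇒1+e+[1+a]<n {n} e a bound = subst (_< n) (≡.sym (cong suc (+-suc e a))) (<⇒≤ bound)

exchange : ∀ {n} e a → suc e + a < n → Vec (PathMatching n) (rounds e)
exchange zero a 1+a<n = adjacentSwap a 1+a<n ∷ []
exchange {n} (suc zero) a 2+a<n =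
  adjacentSwap a 1+a<n ∷ adjacentSwap (suc a) 2+a<n ∷ adjacentSwap a 1+a<n ∷ []
  where
  1+a<n : suc a < n
  1+a<n = <-trans (n<1+n (suc a)) 2+a<n
exchange (suc (suc e)) a bound =
  doubleSwap (1+a<2+e+a e a) bound
    ∷ (exchange e (suc a) (3+e+a<n⇒1+e+[1+a]<n e a bound) ∷ʳ doubleSwap (1+a<2+e+a e a) bound)

compose-exchange : ∀ {n} e a (bound : suc e + a < n) x →
                   compose (exchange e a bound) x ≡ transpose a (suc e + a) x
compose-exchange zero a _ x = refl
compose-exchange (suc zero) a _ x = begin
  swapAt a (swapAt (suc a) (swapAt a x))
    ≡⟨ transpose-conjugate {σ = swapAt a} (transpose-involutive a (suc a)) (suc a) (suc (suc a)) x ⟩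
  transpose (swapAt a (suc a)) (swapAt a (suc (suc a))) x
    ≡⟨ cong₂ (λ y z → transpose y z x) (transpose-matchʳ a (suc a))
             (transpose-fix (>⇒≢ (m<n⇒m<1+n (n<1+n a))) (>⇒≢ (n<1+n (suc a)))) ⟩
  transpose a (suc (suc a)) x
    ∎
  where open ≡-Reasoning
compose-exchange {n} (suc (suc e)) a bound x = begin
  τ (compose (inner ∷ʳ doubleSwap 1+a<b bound) x)
    ≡⟨ cong τ (compose-∷ʳ inner (doubleSwap 1+a<b bound) x) ⟩
  τ (compose inner (τ x))
    ≡⟨ cong τ (compose-exchange e (suc a) inner-bound (τ x)) ⟩
  τ (transpose (suc a) (suc e + suc a) (τ x))
    ≡⟨ transpose-conjugate {σ = τ} (swapBoth-involutive 1+a<b) (suc a) (suc e + suc a) x ⟩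
  transpose (τ (suc a)) (τ (suc e + suc a)) x
    ≡⟨ cong₂ (λ y z → transpose y z x) (swapBoth-suc-a 1+a<b)
             (trans (cong (τ ∘ suc) (+-suc e a)) (swapBoth-b 1+a<b)) ⟩
  transpose a (suc (suc (suc e)) + a) x
    ∎
  where
  open ≡-Reasoning
  1+a<b : suc a < suc (suc e) + a
  1+a<b = 1+a<2+e+a e a
  inner-bound : suc e + suc a < n
  inner-bound = 3+e+a<n⇒1+e+[1+a]<n e a bound
  inner : Vec (PathMatching n) (rounds e)
  inner = exchange e (suc a) inner-bound
  τ : ℕ → ℕ
  τ = swapBoth 1+a<b

sortable-in-rounds : ∀ m → SortableIn (Path (suc (suc m))) (swapEnds (suc (suc m))) (rounds m)
sortable-in-rounds m = map toSwap Ms , matchings-sort Ms (swapEnds (suc (suc m))) sorted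
  where
  Ms : Vec (PathMatching (suc (suc m))) (rounds m)
  Ms = exchange m 0 (s≤s (s≤s (≤-reflexive (+-identityʳ m))))
  ends : ℕ → ℕ
  ends = transpose 0 (suc m)
  sorted : ∀ u v → toℕ v ≡ compose Ms (toℕ u) → swapEnds (suc (suc m)) v ≡ u
  sorted u v v≡Ms[u] = toℕ-injective (begin
    toℕ (swapEnds (suc (suc m)) v)         ≡⟨ toℕ-swapEnds v ⟩
    ends (toℕ v)                           ≡⟨ cong ends v≡Ms[u] ⟩
    ends (compose Ms (toℕ u))              ≡⟨ cong ends (compose-exchange m 0 _ (toℕ u)) ⟩
    ends (transpose 0 (suc m + 0) (toℕ u)) ≡⟨ cong (λ c → ends (transpose 0 c (toℕ u)))
                                                   (+-identityʳ (suc m)) ⟩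
    ends (ends (toℕ u))                    ≡⟨ transpose-involutive 0 (suc m) (toℕ u) ⟩
    toℕ u                                  ∎)
    where open ≡-Reasoning

rounds-even : ∀ m → suc (suc m) % 2 ≡ 0 → rounds m ≡ suc m
rounds-even zero _ = refl
rounds-even (suc zero) ()
rounds-even (suc (suc m)) even = cong (suc ∘ suc) (rounds-even m even)

rounds-odd : ∀ m → suc (suc m) % 2 ≡ 1 → rounds m ≡ suc (suc m)
rounds-odd zero ()
rounds-odd (suc zero) _ = refl
rounds-odd (suc (suc m)) odd = cong (suc ∘ suc) (rounds-odd m odd)

odd⇒pred≡2*half : ∀ m → suc (suc m) % 2 ≡ 1 → suc m ≡ 2 * (suc (suc m) / 2)
odd⇒pred≡2*half m odd = suc-injective (begin
  suc (suc m)                             ≡⟨ m≡m%n+[m/n]*n (suc (suc m)) 2 ⟩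
  suc (suc m) % 2 + (suc (suc m) / 2) * 2 ≡⟨ cong₂ _+_ odd (*-comm (suc (suc m) / 2) 2) ⟩
  suc (2 * (suc (suc m) / 2))             ∎)
  where open ≡-Reasoning

not-sortable-below-distance : ∀ m k → k < suc m → ¬ SortableIn (Path (suc (suc m))) (swapEnds (suc (suc m))) k
not-sortable-below-distance m k k<1+m (_ , sorting) =
  <⇒≱ k<1+m (subst (_≤ k) (toℕ-fromℕ (suc m)) (displacement sorting {u = fzero} refl))

odd-not-sortable-in-distance : ∀ m → suc (suc m) % 2 ≡ 1 →
                               ¬ SortableIn (Path (suc (suc m))) (swapEnds (suc (suc m))) (suc m)
odd-not-sortable-in-distance m odd (_ , sorting) = 1+n≢0 (begin
  suc m                                 ≡⟨ ≡.sym (toℕ-fromℕ (suc m)) ⟩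
  toℕ last                              ≡⟨ cong toℕ ends-meet ⟩
  toℕ (swapEnds (suc (suc m)) last)     ≡⟨ last↦0 ⟩
  0                                     ∎)
  where
  open ≡-Reasoning
  last : Fin (suc (suc m))
  last = fromℕ (suc m)
  j : ℕ
  j = suc (suc m) / 2
  1+m≡2j : suc m ≡ 2 * j
  1+m≡2j = odd⇒pred≡2*half m odd
  last↦0 : toℕ (swapEnds (suc (suc m)) last) ≡ 0
  last↦0 = trans (toℕ-swapEnds last)
                 (trans (cong (transpose 0 (suc m)) (toℕ-fromℕ (suc m))) (transpose-matchʳ 0 (suc m)))
  ends-meet : last ≡ swapEnds (suc (suc m)) last
  ends-meet = collide j sorting {p = fzero} {q = last} {a = last} refl refl
    (toℕ-fromℕ (suc m))
    (trans (toℕ-fromℕ (suc m)) (cong (_+ suc m) (≡.sym last↦0)))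
    (trans (toℕ-fromℕ (suc m)) 1+m≡2j)
    (subst (j ≤_) (≡.sym 1+m≡2j) (m≤m+n j (j + 0)))

lemma3 : (n : ℕ) → 2 ≤ n →
    (n % 2 ≡ 0 → RtIs (Path n) (swapEnds n) (n ∸ 1))
    × (n % 2 ≡ 1 → RtIs (Path n) (swapEnds n) n)
lemma3 (suc (suc m)) (s≤s (s≤s z≤n)) = even-case , odd-case
  where
  even-case : suc (suc m) % 2 ≡ 0 → RtIs (Path (suc (suc m))) (swapEnds (suc (suc m))) (suc m)
  even-case even = subst (SortableIn _ _) (rounds-even m even) (sortable-in-rounds m)
                 , not-sortable-below-distance m
  odd-case : suc (suc m) % 2 ≡ 1 → RtIs (Path (suc (suc m))) (swapEnds (suc (suc m))) (suc (suc m))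
  odd-case odd = subst (SortableIn _ _) (rounds-odd m odd) (sortable-in-rounds m) , too-few
    where
    too-few : ∀ k → k < suc (suc m) → ¬ SortableIn (Path (suc (suc m))) (swapEnds (suc (suc m))) k
    too-few k k<2+m with m≤n⇒m<n∨m≡n (s≤s⁻¹ k<2+m)
    ... | inj₁ k<1+m = not-sortable-below-distance m k k<1+m
    ... | inj₂ refl = odd-not-sortable-in-distance m odd
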